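{- Let $\mathcal{A}$ be a contract automaton in the flow setting described in the context and let $\vec x=(x_{t_1},\ldots,x_{t_n})\in F_x$. Then there exists a run $(w,\vec q_0)\to^*(\epsilon,\vec q_f)$ of $\mathcal{A}$ that passes through each transition $t_j\in T$ exactly $x_{t_j}$ times.
   Context: A contract automaton (CA) of rank $r$ is $\langle Q,\vec q_0,A^r,A^o,T,F\rangle$ with $Q=Q_1\times\cdots\times Q_r$ finite, initial state $\vec q_0$, finite sets of requests $A^r$ and offers $A^o$, final states $F\subseteq Q$, and transitions $T\subseteq Q\times(\text{labels})\times Q$ where labels are vectors (requests, offers or matches). A step $(w,\vec q)\to(w',\vec q')$ occurs iff $w=\vec aw'$ and $(\vec q,\vec a,\vec q')\in T$; a run passes through the transitions used in its steps. Flow setting: $\mathcal{A}$ has a single final state $\vec q_f\ne\vec q_0$, every state is reachable from $\vec q_0$, and $\vec q_f$ is reachable from every state; $T=\{t_1,\ldots,t_n\}$. $FS(\vec q)$ and $BS(\vec q)$ are the sets of transitions leaving and entering $\vec q$. For states $\vec s,\vec d$, $F_{\vec s,\vec d}$ is the set of $(x_{t_1},\ldots,x_{t_n})\in\mathbb{N}^n$ for which there exist reals $z^{\vec q}_{t_i}$ ($\vec q\in Q$, $\vec q\ne\vec s$, $t_i\in T$) such that: for all $\vec q$, $\sum_{t_i\in BS(\vec q)}x_{t_i}-\sum_{t_i\in FS(\vec q)}x_{t_i}$ equals $-1$ if $\vec q=\vec s$, $1$ if $\vec q=\vec d$, $0$ otherwise; for all $\vec q\ne\vec s$ and $t_i$,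 $0\le z^{\vec q}_{t_i}\le x_{t_i}$; for all $\vec q\ne\vec s$ and all $\vec q'$, $\sum_{t_i\in BS(\vec q')}z^{\vec q}_{t_i}-\sum_{t_i\in FS(\vec q')}z^{\vec q}_{t_i}$ equals $-p^{\vec q}$ if $\vec q'=\vec s$, $p^{\vec q}$ if $\vec q'=\vec q$, $0$ otherwise, where $p^{\vec q}=1$ if $\sum_{t_i\in FS(\vec q)}x_{t_i}>0$ and $p^{\vec q}=0$ otherwise. $F_x=F_{\vec q_0,\vec q_f}$.
   Formalization: The auxiliary variables $z^{\vec q}_{t_i}$ defining $F_x$ are rational rather than real. -}

module Defs where

open import Data.Nat using (ℕ; zero; suc; _+_; _>_)
open import Data.Fin using (Fin; zero; suc; _≟_)
open import Data.Vec using (Vec)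
open import Data.List using (List; []; _∷_)
open import Data.Product using (Σ; ∃; _×_; _,_)
open import Data.Integer as ℤ using (ℤ)
open import Data.Rational as ℚ using (ℚ)
open import Relation.Nullary using (¬_; yes; no)
open import Relation.Binary.PropositionalEquality using (_≡_)

data Action (Act : Set) : Set where
  idle : Action Act
  req  : Act → Action Act
  off  : Act → Action Act

-- The state space Q = Q₁ × ⋯ × Qᵣ is finite; it is
-- represented (up to bijection) by Fin nQ.  The finite transition set
-- T = {t₁,…,tₙ} is indexed by Fin n; transition i is (src i , lab i , tgt i).
record CA : Set₁ where
  field
    rank  : ℕ
    Act   : Set
    nQ    : ℕ
    q0    : Fin nQ
    n     : ℕ
    src   : Fin n → Fin nQ
    lab   : Fin n → Vec (Action Act) rank
    tgt   : Fin n → Fin nQ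
    -- T is a set: distinct indices denote distinct transitions
    trans-inj : ∀ i j → src i ≡ src j → lab i ≡ lab j → tgt i ≡ tgt j → i ≡ j

module _ (A : CA) where
  open CA A

  Label : Set
  Label = Vec (Action Act) rank

  Config : Set
  Config = List Label × Fin nQ

  Step : Config → Fin n → Config → Set
  Step (w , q) t (w' , q') = (w ≡ lab t ∷ w') × (src t ≡ q) × (tgt t ≡ q')

  data Steps : Config → List (Fin n) → Config → Set where
    done : ∀ {c} → Steps c [] c
    more : ∀ {c c' c'' t ts} → Step c t c' → Steps c' ts c'' → Steps c (t ∷ ts) c''

  Reachable : Fin nQ → Fin nQ → Set
  Reachable q q' = Σ (List Label) λ w → Σ (List (Fin n)) λ ts → Steps (w , q) ts ([] , q')

  FlowSetting : Fin nQ → Set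
  FlowSetting qf = (¬ qf ≡ q0) × (∀ q → Reachable q0 q) × (∀ q → Reachable q qf)

sumℕ : ∀ {k} → (Fin k → ℕ) → ℕ
sumℕ {zero}  f = 0
sumℕ {suc k} f = f zero + sumℕ (λ i → f (suc i))

sumℚ : ∀ {k} → (Fin k → ℚ) → ℚ
sumℚ {zero}  f = ℚ.0ℚ
sumℚ {suc k} f = f zero ℚ.+ sumℚ (λ i → f (suc i))

sumℤ : ∀ {k} → (Fin k → ℤ) → ℤ
sumℤ {zero}  f = ℤ.0ℤ
sumℤ {suc k} f = f zero ℤ.+ sumℤ (λ i → f (suc i))

when : ∀ {m} {B : Set} → Fin m → Fin m → B → B → B
when a b x y with a ≟ b
... | yes _ = x
... | no  _ = y

ℕ→ℚ : ℕ → ℚ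
ℕ→ℚ k = ℤ.+ k ℚ./ 1

count : ∀ {k} → Fin k → List (Fin k) → ℕ
count j []       = 0
count j (t ∷ ts) = when j t 1 0 + count j ts

module _ (A : CA) where
  open CA A

  inℤ outℤ : (Fin n → ℤ) → Fin nQ → ℤ
  inℤ  y q = sumℤ λ i → when (tgt i) q (y i) ℤ.0ℤ
  outℤ y q = sumℤ λ i → when (src i) q (y i) ℤ.0ℤ

  inℚ outℚ : (Fin n → ℚ) → Fin nQ → ℚ
  inℚ  y q = sumℚ λ i → when (tgt i) q (y i) ℚ.0ℚ
  outℚ y q = sumℚ λ i → when (src i) q (y i) ℚ.0ℚ

  outℕ : (Fin n → ℕ) → Fin nQ → ℕ
  outℕ x q = sumℕ λ i → when (src i) q (x i) 0

  p : (Fin n → ℕ) → Fin nQ → ℚ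
  p x q with outℕ x q
  ... | zero  = ℚ.0ℚ
  ... | suc _ = ℚ.1ℚ

  InF : Fin nQ → Fin nQ → (Fin n → ℕ) → Set
  InF s d x =
    (∀ q → inℤ (λ i → ℤ.+ x i) q ℤ.- outℤ (λ i → ℤ.+ x i) q
             ≡ when q s (ℤ.- ℤ.1ℤ) (when q d ℤ.1ℤ ℤ.0ℤ))
    × Σ (Fin nQ → Fin n → ℚ) λ z →
        (∀ q → ¬ q ≡ s → ∀ i → (ℚ.0ℚ ℚ.≤ z q i) × (z q i ℚ.≤ ℕ→ℚ (x i)))
      × (∀ q → ¬ q ≡ s → ∀ q' →
           inℚ (z q) q' ℚ.- outℚ (z q) q'
             ≡ when q' s (ℚ.- p x q) (when q' q (p x q) ℚ.0ℚ))

  Fx : Fin nQ → (Fin n → ℕ) → Set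
  Fx qf = InF q0 qf

{-# OPTIONS --safe #-}
-- The balance equations say that x is a flow of value 1 from q0 to qf, so Hierholzer's
-- construction of an Euler trail applies: walk greedily from q0 along unused transitions until qf is
-- reached, then repeatedly splice in a closed trail at a visited state that still has an unused
-- outgoing transition.  This can only get stuck if every unused transition starts outside the set S
-- of visited states, which x never leaves.  For the source u of such a transition, summing the
-- balance equations of the auxiliary flow z^u over S shows that its value p^u must leave S through
-- transitions t with z^u_t <= x_t = 0; hence p^u = 0, i.e. u has no outgoing x-flow, contradicting
-- the choice of u.
module Submission where

open import Defs
open import Level using (0ℓ)
open import Algebra.Bundles using (CommutativeMonoid; CommutativeRing)
open import Data.Fin using (Fin; zero; suc; _≟_; punchIn)
open import Data.Fin.Properties using (punchInᵢ≢i; any?)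
open import Data.List using (List; []; _∷_; _++_; map)
open import Data.List.Membership.Propositional using (_∈_)
open import Data.List.Relation.Unary.Any using (here; there)
open import Data.Nat as ℕ using (ℕ; zero; suc)
import Data.Nat.Properties as ℕP
open import Data.Nat.Induction using (<-wellFounded)
open import Data.Product using (Σ; ∃; ∃₂; _×_; _,_; proj₁; proj₂)
open import Data.Vec.Functional using (zipWith)
open import Function using (_∘_)
open import Induction.WellFounded using (Acc; acc)
open import Relation.Binary.PropositionalEquality
  using (_≡_; _≢_; _≗_; refl; sym; trans; cong; cong₂; subst; module ≡-Reasoning)
open import Relation.Nullary using (¬_; Dec; yes; no; contradiction; _×-dec_)
open import Relation.Unary using (Pred; Decidable)

when-≡ : ∀ {m} {B : Set} {a b : Fin m} {x y : B} → a ≡ b → when a b x y ≡ x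
when-≡ {a = a} {b} a≡b with a ≟ b
... | yes _   = refl
... | no a≢b  = contradiction a≡b a≢b

when-≢ : ∀ {m} {B : Set} {a b : Fin m} {x y : B} → a ≢ b → when a b x y ≡ y
when-≢ {a = a} {b} a≢b with a ≟ b
... | yes a≡b = contradiction a≡b a≢b
... | no _    = refl

when-idem : ∀ {m} {B : Set} (a b : Fin m) (x : B) → when a b x x ≡ x
when-idem a b x with a ≟ b
... | yes _ = refl
... | no _  = refl

when-comm : ∀ {m} {B : Set} (a b : Fin m) {x y : B} → when a b x y ≡ when b a x y
when-comm a b with a ≟ b | b ≟ a
... | yes _   | yes _   = refl
... | yes a≡b | no b≢a  = contradiction (sym a≡b) b≢a
... | no a≢b  | yes b≡a = contradiction (sym b≡a) a≢b
... | no _    | no _    = refl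

¬0<⇒≡0 : ∀ {k} → ¬ 0 ℕ.< k → k ≡ 0
¬0<⇒≡0 = ℕP.n≤0⇒n≡0 ∘ ℕP.≮⇒≥

module FinSum (M : CommutativeMonoid 0ℓ 0ℓ) where
  open CommutativeMonoid M using (Carrier; _≈_; _∙_; ε; ∙-congˡ; identityʳ; setoid)
  open import Algebra.Properties.CommutativeMonoid.Sum M public
  open import Relation.Binary.Reasoning.Setoid setoid

  ∑-when : ∀ {k} (t : Fin k) (c : Carrier) → sum (λ i → when i t c ε) ≈ c
  ∑-when {suc k} t c = begin
    sum f                     ≈⟨ sum-remove f ⟩
    f t ∙ sum (f ∘ punchIn t) ≡⟨ cong₂ _∙_ (when-≡ {a = t} {y = ε} refl) (sum-cong-≗ elsewhere) ⟩
    c ∙ sum {k} (λ _ → ε)     ≈⟨ ∙-congˡ (sum-replicate-zero k) ⟩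
    c ∙ ε                     ≈⟨ identityʳ c ⟩
    c                         ∎
    where
    f : Fin (suc k) → Carrier
    f i = when i t c ε
    elsewhere : ∀ j → f (punchIn t j) ≡ ε
    elsewhere j = when-≢ (punchInᵢ≢i t j)

module Flows (A : CA) where
  open CA A
  open import Data.Integer as ℤ using (ℤ; +_; 0ℤ; 1ℤ; -1ℤ; _+_; _-_; -_; _≤_)
  import Data.Integer.Properties as ℤP
  open import Data.Integer.Tactic.RingSolver using (solve-∀)
  open FinSum ℤP.+-0-commutativeMonoid

  sumℤ≡sum : ∀ {k} (f : Fin k → ℤ) → sumℤ f ≡ sum f
  sumℤ≡sum {zero}  f = refl
  sumℤ≡sum {suc k} f = cong (_+_ (f zero)) (sumℤ≡sum (f ∘ suc))

  ∑-nonneg : ∀ {k} (f : Fin k → ℤ) → (∀ i → 0ℤ ≤ f i) → 0ℤ ≤ sum f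
  ∑-nonneg {zero}  f f≥0 = ℤP.≤-refl
  ∑-nonneg {suc k} f f≥0 = ℤP.+-mono-≤ (f≥0 zero) (∑-nonneg (f ∘ suc) (f≥0 ∘ suc))

  infixl 6 _⊕_

  _⊕_ : (Fin n → ℕ) → (Fin n → ℕ) → Fin n → ℕ
  _⊕_ = zipWith ℕ._+_

  𝟙 : Fin n → Fin n → ℕ
  𝟙 t j = when j t 1 0

  flow : (Fin n → Fin nQ) → (Fin n → ℕ) → Fin nQ → ℤ
  flow end y q = sum (λ i → when (end i) q (+ y i) 0ℤ)

  net : (Fin n → ℕ) → Fin nQ → ℤ
  net y q = flow tgt y q - flow src y q

  ∂ : Fin nQ → Fin nQ → Fin nQ → ℤ
  ∂ s d q = when q d 1ℤ 0ℤ - when q s 1ℤ 0ℤ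

  Balanced : (Fin n → ℕ) → Fin nQ → Fin nQ → Set
  Balanced y s d = net y ≗ ∂ s d

  module _ (end : Fin n → Fin nQ) (q : Fin nQ) where
    private
      term : (Fin n → ℕ) → Fin n → ℤ
      term y i = when (end i) q (+ y i) 0ℤ

    flow-⊕ : ∀ a b → flow end (a ⊕ b) q ≡ flow end a q + flow end b q
    flow-⊕ a b = trans (sum-cong-≗ split) (∑-distrib-+ (term a) (term b))
      where
      split : ∀ i → term (a ⊕ b) i ≡ term a i + term b i
      split i with end i ≟ q
      ... | yes _ = ℤP.pos-+ (a i) (b i)
      ... | no _  = refl

    flow-𝟙 : ∀ t → flow end (𝟙 t) q ≡ when (end t) q 1ℤ 0ℤ
    flow-𝟙 t = trans (sum-cong-≗ only-t) (∑-when t _)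
      where
      only-t : ∀ i → when (end i) q (+ 𝟙 t i) 0ℤ ≡ when i t (when (end t) q 1ℤ 0ℤ) 0ℤ
      only-t i with i ≟ t
      ... | yes refl = refl
      ... | no _     = when-idem (end i) q 0ℤ

    flow-0 : flow end (λ _ → 0) q ≡ 0ℤ
    flow-0 = trans (sum-cong-≗ (λ i → when-idem (end i) q 0ℤ)) (sum-replicate-zero n)

    flow-cong : ∀ {y y′} → y ≗ y′ → flow end y q ≡ flow end y′ q
    flow-cong y≗y′ = sum-cong-≗ (λ i → cong (λ k → when (end i) q (+ k) 0ℤ) (y≗y′ i))

  net-cong : ∀ {y y′} → y ≗ y′ → net y ≗ net y′
  net-cong y≗y′ q = cong₂ _-_ (flow-cong tgt q y≗y′) (flow-cong src q y≗y′)

  net-⊕ : ∀ a b q → net (a ⊕ b) q ≡ net a q + net b q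
  net-⊕ a b q = begin
    flow tgt (a ⊕ b) q - flow src (a ⊕ b) q
      ≡⟨ cong₂ _-_ (flow-⊕ tgt q a b) (flow-⊕ src q a b) ⟩
    (flow tgt a q + flow tgt b q) - (flow src a q + flow src b q)
      ≡⟨ interchange (flow tgt a q) (flow tgt b q) (flow src a q) (flow src b q) ⟩
    net a q + net b q ∎
    where
    open ≡-Reasoning
    interchange : ∀ (w x y z : ℤ) → (w + x) - (y + z) ≡ (w - y) + (x - z)
    interchange = solve-∀

  balanced-𝟙 : ∀ t → Balanced (𝟙 t) (src t) (tgt t)
  balanced-𝟙 t q =
    cong₂ _-_ (trans (flow-𝟙 tgt q t) (when-comm (tgt t) q)) (trans (flow-𝟙 src q t) (when-comm (src t) q))

  balanced-0 : ∀ v → Balanced (λ _ → 0) v v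
  balanced-0 v q = begin
    flow tgt (λ _ → 0) q - flow src (λ _ → 0) q ≡⟨ cong₂ _-_ (flow-0 tgt q) (flow-0 src q) ⟩
    0ℤ                                          ≡⟨ sym (ℤP.+-inverseʳ (when q v 1ℤ 0ℤ)) ⟩
    ∂ v v q                                     ∎
    where open ≡-Reasoning

  balanced-⊕ : ∀ {a b s m d} → Balanced a s m → Balanced b m d → Balanced (a ⊕ b) s d
  balanced-⊕ {a} {b} {s} {m} {d} bal-a bal-b q = begin
    net (a ⊕ b) q     ≡⟨ net-⊕ a b q ⟩
    net a q + net b q ≡⟨ cong₂ _+_ (bal-a q) (bal-b q) ⟩
    ∂ s m q + ∂ m d q ≡⟨ telescope (when q s 1ℤ 0ℤ) (when q m 1ℤ 0ℤ) (when q d 1ℤ 0ℤ) ⟩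
    ∂ s d q           ∎
    where
    open ≡-Reasoning
    telescope : ∀ (s m d : ℤ) → (m - s) + (d - m) ≡ d - s
    telescope = solve-∀

  balanced-cancel : ∀ {y a b s m d} → y ≗ a ⊕ b → Balanced y s d → Balanced a s m → Balanced b m d
  balanced-cancel {y} {a} {b} {s} {m} {d} y≗a⊕b bal-y bal-a q = begin
    net b q                       ≡⟨ cancel (net a q) (net b q) ⟩
    (net a q + net b q) - net a q ≡⟨ cong₂ _-_ (sym (net-⊕ a b q)) (bal-a q) ⟩
    net (a ⊕ b) q - ∂ s m q       ≡⟨ cong (_- ∂ s m q) (trans (sym (net-cong y≗a⊕b q)) (bal-y q)) ⟩
    ∂ s d q - ∂ s m q             ≡⟨ telescope (when q s 1ℤ 0ℤ) (when q m 1ℤ 0ℤ) (when q d 1ℤ 0ℤ) ⟩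
    ∂ m d q                       ∎
    where
    open ≡-Reasoning
    cancel : ∀ (x y : ℤ) → y ≡ (x + y) - x
    cancel = solve-∀
    telescope : ∀ (s m d : ℤ) → (d - s) - (m - s) ≡ d - m
    telescope = solve-∀

  circulation-rebase : ∀ {y v} w → Balanced y v v → Balanced y w w
  circulation-rebase {v = v} w bal q =
    trans (bal q) (trans (ℤP.+-inverseʳ (when q v 1ℤ 0ℤ)) (sym (ℤP.+-inverseʳ (when q w 1ℤ 0ℤ))))

  source-exit : ∀ {y v b} → Balanced y v b → v ≢ b → ∃ λ i → src i ≡ v × 0 ℕ.< y i
  source-exit {y} {v} {b} bal v≢b with any? (λ i → (src i ≟ v) ×-dec (0 ℕ.<? y i))
  ... | yes found = found
  ... | no none   = contradiction 0≤-1 λ ()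
    where
    no-outflow : ∀ i → when (src i) v (+ y i) 0ℤ ≡ 0ℤ
    no-outflow i with src i ≟ v
    ... | yes e = cong +_ (¬0<⇒≡0 (λ pos → none (i , e , pos)))
    ... | no _  = refl
    outflow≡0 : flow src y v ≡ 0ℤ
    outflow≡0 = trans (sum-cong-≗ no-outflow) (sum-replicate-zero n)
    inflow≥0 : ∀ i → 0ℤ ≤ when (tgt i) v (+ y i) 0ℤ
    inflow≥0 i with tgt i ≟ v
    ... | yes _ = ℤ.+≤+ ℕ.z≤n
    ... | no _  = ℤP.≤-refl
    open ℤP.≤-Reasoning
    0≤-1 : 0ℤ ≤ -1ℤ
    0≤-1 = begin
      0ℤ                ≤⟨ ∑-nonneg _ inflow≥0 ⟩
      flow tgt y v      ≡⟨ sym (ℤP.+-identityʳ _) ⟩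
      flow tgt y v - 0ℤ ≡⟨ cong (_-_ (flow tgt y v)) (sym outflow≡0) ⟩
      net y v           ≡⟨ bal v ⟩
      ∂ v b v           ≡⟨ cong₂ _-_ (when-≢ {x = 1ℤ} {0ℤ} v≢b) (when-≡ {a = v} {x = 1ℤ} {0ℤ} refl) ⟩
      -1ℤ               ∎

  InF⇒balanced : ∀ {s d x} → s ≢ d →
    (∀ q → inℤ A (λ i → + x i) q - outℤ A (λ i → + x i) q ≡ when q s (- 1ℤ) (when q d 1ℤ 0ℤ)) →
    Balanced x s d
  InF⇒balanced {s} {d} {x} s≢d balance q = begin
    net x q
      ≡⟨ cong₂ _-_ (sym (sumℤ≡sum (into tgt))) (sym (sumℤ≡sum (into src))) ⟩
    inℤ A (λ i → + x i) q - outℤ A (λ i → + x i) q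
      ≡⟨ balance q ⟩
    when q s (- 1ℤ) (when q d 1ℤ 0ℤ)
      ≡⟨ boundary ⟩
    ∂ s d q
      ∎
    where
    open ≡-Reasoning
    into : (Fin n → Fin nQ) → Fin n → ℤ
    into end i = when (end i) q (+ x i) 0ℤ
    boundary : when q s (- 1ℤ) (when q d 1ℤ 0ℤ) ≡ ∂ s d q
    boundary with q ≟ s | q ≟ d
    ... | yes refl | yes refl = contradiction refl s≢d
    ... | yes refl | no _     = refl
    ... | no _     | yes refl = refl
    ... | no _     | no _     = refl

module Euler (A : CA) where
  open CA A
  open Flows A
  open import Data.Nat using (_+_; _∸_; _≤_; _<_; z≤n; _<?_)
  open import Data.Nat.Tactic.RingSolver using (solve-∀)
  open FinSum ℕP.+-0-commutativeMonoid using (sum; sum-cong-≗; ∑-distrib-+; ∑-when)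
  open import Data.List.Membership.DecPropositional (_≟_ {n = nQ}) using (_∈?_)

  infixr 5 _∷_ _++ᵖ_

  data Path : Fin nQ → List (Fin n) → Fin nQ → Set where
    []  : ∀ {q} → Path q [] q
    _∷_ : ∀ {q t ts q′} → src t ≡ q → Path (tgt t) ts q′ → Path q (t ∷ ts) q′

  _++ᵖ_ : ∀ {a xs b ys c} → Path a xs b → Path b ys c → Path a (xs ++ ys) c
  []      ++ᵖ q = q
  (e ∷ p) ++ᵖ q = e ∷ (p ++ᵖ q)

  states : Fin nQ → List (Fin n) → List (Fin nQ)
  states a ts = a ∷ map tgt ts

  split-at : ∀ {a ts b v} → Path a ts b → v ∈ states a ts →
    ∃₂ λ ts₁ ts₂ → ts ≡ ts₁ ++ ts₂ × Path a ts₁ v × Path v ts₂ b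
  split-at p       (here refl)  = [] , _ , refl , [] , p
  split-at []      (there ())
  split-at (e ∷ p) (there v∈) with split-at p v∈
  ... | ts₁ , ts₂ , refl , p₁ , p₂ = _ ∷ ts₁ , ts₂ , refl , e ∷ p₁ , p₂

  steps : ∀ {a ts b} → Path a ts b → Steps A (map lab ts , a) ts ([] , b)
  steps []      = done
  steps (e ∷ p) = more (refl , e , refl) (steps p)

  occurrences : List (Fin n) → Fin n → ℕ
  occurrences ts j = count j ts

  occurrences-++ : ∀ xs ys → occurrences (xs ++ ys) ≗ occurrences xs ⊕ occurrences ys
  occurrences-++ []       ys j = refl
  occurrences-++ (t ∷ xs) ys j =
    trans (cong (𝟙 t j +_) (occurrences-++ xs ys j)) (sym (ℕP.+-assoc (𝟙 t j) _ _))

  occurs⇒tgt∈ : ∀ j ts → 0 < count j ts → tgt j ∈ map tgt ts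
  occurs⇒tgt∈ j (t ∷ ts) pos with j ≟ t
  ... | yes refl = here refl
  ... | no _     = there (occurs⇒tgt∈ j ts pos)

  path-balanced : ∀ {a ts b} → Path a ts b → Balanced (occurrences ts) a b
  path-balanced {a} []    = balanced-0 a
  path-balanced (refl ∷ p) = balanced-⊕ (balanced-𝟙 _) (path-balanced p)

  split-off : ∀ (y : Fin n → ℕ) {t} → 0 < y t → ∃ λ y′ → y ≗ 𝟙 t ⊕ y′
  split-off y {t} pos = (λ j → y j ∸ 𝟙 t j) , λ j → sym (ℕP.m+[n∸m]≡n (𝟙≤y j))
    where
    𝟙≤y : ∀ j → 𝟙 t j ≤ y j
    𝟙≤y j with j ≟ t
    ... | yes refl = pos
    ... | no _     = z≤n

  removal-decreases-sum : ∀ {y y′ t} → y ≗ 𝟙 t ⊕ y′ → sum y′ < sum y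
  removal-decreases-sum {y} {y′} {t} y≗ = ℕP.≤-reflexive (sym (begin
    sum y               ≡⟨ sum-cong-≗ y≗ ⟩
    sum (𝟙 t ⊕ y′)      ≡⟨ ∑-distrib-+ (𝟙 t) y′ ⟩
    sum (𝟙 t) + sum y′  ≡⟨ cong (_+ sum y′) (∑-when t 1) ⟩
    suc (sum y′)        ∎))
    where open ≡-Reasoning

  record Trail (y : Fin n → ℕ) (v b : Fin nQ) : Set where
    field
      route  : List (Fin n)
      unused : Fin n → ℕ
      path   : Path v route b
      splits : y ≗ occurrences route ⊕ unused

  open Trail

  empty-trail : ∀ y v → Trail y v v
  empty-trail y v = record { route = [] ; unused = y ; path = [] ; splits = λ _ → refl }

  infixr 5 _◅_

  _◅_ : ∀ {y y′ t b} → y ≗ 𝟙 t ⊕ y′ → Trail y′ (tgt t) b → Trail y (src t) b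
  _◅_ {t = t} y≗ T = record
    { route  = t ∷ route T
    ; unused = unused T
    ; path   = refl ∷ path T
    ; splits = λ j → trans (y≗ j) (trans (cong (𝟙 t j +_) (splits T j)) (sym (ℕP.+-assoc (𝟙 t j) _ _)))
    }

  sum-unused≤ : ∀ {y v b} (T : Trail y v b) → sum (unused T) ≤ sum y
  sum-unused≤ {y} T = begin
    sum (unused T)                                ≤⟨ ℕP.m≤n+m _ _ ⟩
    sum (occurrences (route T)) + sum (unused T)  ≡⟨ sym (∑-distrib-+ (occurrences (route T)) (unused T)) ⟩
    sum (occurrences (route T) ⊕ unused T)        ≡⟨ sym (sum-cong-≗ (splits T)) ⟩
    sum y                                         ∎
    where open ℕP.≤-Reasoning

  greedy-trail : ∀ {y v b} → Acc _<_ (sum y) → Balanced y v b → Trail y v b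
  greedy-trail {y} {v} {b} (acc smaller) bal with v ≟ b
  ... | yes refl = empty-trail y v
  ... | no v≢b with source-exit bal v≢b
  ... | i , refl , pos with split-off y pos
  ... | y′ , y≗ =
    y≗ ◅ greedy-trail (smaller (removal-decreases-sum y≗)) (balanced-cancel y≗ bal (balanced-𝟙 i))

  splice : ∀ {x s d v} (T : Trail x s d) (C : Trail (unused T) v v) {ts₁ ts₂} →
    route T ≡ ts₁ ++ ts₂ → Path s ts₁ v → Path v ts₂ d → Trail x s d
  splice {x} T C {ts₁} {ts₂} eq p₁ p₂ = record
    { route  = ts₁ ++ route C ++ ts₂
    ; unused = unused C
    ; path   = p₁ ++ᵖ path C ++ᵖ p₂
    ; splits = counts
    }
    where
    counts : x ≗ occurrences (ts₁ ++ route C ++ ts₂) ⊕ unused C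
    counts j = begin
      x j
        ≡⟨ splits T j ⟩
      count j (route T) + unused T j
        ≡⟨ cong₂ _+_ (trans (cong (count j) eq) (occurrences-++ ts₁ ts₂ j)) (splits C j) ⟩
      (count j ts₁ + count j ts₂) + (count j (route C) + unused C j)
        ≡⟨ rearrange (count j ts₁) (count j ts₂) (count j (route C)) (unused C j) ⟩
      (count j ts₁ + (count j (route C) + count j ts₂)) + unused C j
        ≡⟨ cong (_+ unused C j) (sym spliced-counts) ⟩
      count j (ts₁ ++ route C ++ ts₂) + unused C j
        ∎
      where
      open ≡-Reasoning
      rearrange : ∀ a b c u → (a + b) + (c + u) ≡ (a + (c + b)) + u
      rearrange = solve-∀
      spliced-counts : count j (ts₁ ++ route C ++ ts₂) ≡ count j ts₁ + (count j (route C) + count j ts₂)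
      spliced-counts =
        trans (occurrences-++ ts₁ _ j) (cong (count j ts₁ +_) (occurrences-++ (route C) ts₂ j))

  detour : ∀ {x s d} → Balanced x s d → (T : Trail x s d) →
    ∀ {i} → src i ∈ states s (route T) → 0 < unused T i →
    Σ (Trail x s d) λ T′ → sum (unused T′) < sum (unused T)
  detour bal T {i} visited pos with split-off (unused T) pos | split-at (path T) visited
  ... | r′ , r≗ | _ , _ , eq , p₁ , p₂ = splice T cycle eq p₁ p₂ , shrinks
    where
    circulation : Balanced (unused T) (src i) (src i)
    circulation = circulation-rebase (src i) (balanced-cancel (splits T) bal (path-balanced (path T)))
    back : Trail r′ (tgt i) (src i)
    back = greedy-trail (<-wellFounded (sum r′)) (balanced-cancel r≗ circulation (balanced-𝟙 i))
    cycle : Trail (unused T) (src i) (src i)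
    cycle = r≗ ◅ back
    shrinks : sum (unused back) < sum (unused T)
    shrinks = ℕP.≤-<-trans (sum-unused≤ back) (removal-decreases-sum r≗)

  Closed : (Fin n → ℕ) → Pred (Fin nQ) 0ℓ → Set
  Closed x S = ∀ i → S (src i) → ¬ S (tgt i) → x i ≡ 0

  -- Cut form of: every transition used by x starts at a state that is reachable from s along
  -- transitions used by x.
  ReachableSupport : (Fin n → ℕ) → Fin nQ → Set₁
  ReachableSupport x s = ∀ {S} → Decidable S → S s → Closed x S → ∀ j → ¬ S (src j) → x j ≡ 0

  trail-complete : ∀ {x s d} → ReachableSupport x s → (T : Trail x s d) →
    (∀ i → src i ∈ states s (route T) → unused T i ≡ 0) → occurrences (route T) ≗ x
  trail-complete {x} {s} reach T stuck j = begin
    count j (route T)                   ≡⟨ sym (ℕP.+-identityʳ _) ⟩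
    count j (route T) + 0               ≡⟨ cong (count j (route T) +_) (sym (unused-zero j)) ⟩
    count j (route T) + unused T j      ≡⟨ sym (splits T j) ⟩
    x j                                 ∎
    where
    open ≡-Reasoning
    Visited : Pred (Fin nQ) 0ℓ
    Visited q = q ∈ states s (route T)
    closed : Closed x Visited
    closed i from ¬to = trans (splits T i) (cong₂ _+_ never-taken (stuck i from))
      where
      never-taken : count i (route T) ≡ 0
      never-taken = ¬0<⇒≡0 (λ pos → ¬to (there (occurs⇒tgt∈ i (route T) pos)))
    unused-zero : ∀ j → unused T j ≡ 0
    unused-zero j with src j ∈? states s (route T)
    ... | yes visited = stuck j visited
    ... | no ¬visited = ℕP.m+n≡0⇒n≡0 (count j (route T))
      (trans (sym (splits T j)) (reach (_∈? states s (route T)) (here refl) closed j ¬visited))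

  hierholzer : ∀ {x s d} → Balanced x s d → ReachableSupport x s →
    (T : Trail x s d) → Acc _<_ (sum (unused T)) → ∃ λ ts → Path s ts d × occurrences ts ≗ x
  hierholzer {x} {s} bal reach T (acc smaller)
    with any? (λ i → (src i ∈? states s (route T)) ×-dec (0 <? unused T i))
  ... | yes (i , visited , pos) = let T′ , shrinks = detour bal T visited pos in
                                  hierholzer bal reach T′ (smaller shrinks)
  ... | no stuck =
    route T , path T , trail-complete reach T (λ i visited → ¬0<⇒≡0 (λ pos → stuck (i , visited , pos)))

  euler-path : ∀ {x s d} → Balanced x s d → ReachableSupport x s → ∃ λ ts → Path s ts d × occurrences ts ≗ x
  euler-path bal reach = hierholzer bal reach (greedy-trail (<-wellFounded _) bal) (<-wellFounded _)

module Cut (A : CA) where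
  open CA A
  open Euler A using (Closed; ReachableSupport)
  open import Data.Rational using (ℚ; 0ℚ; 1ℚ; _+_; _-_; -_; _*_; _≤_; *≤*)
  import Data.Rational.Properties as ℚP
  open import Data.Rational.Solver using (module +-*-Solver)
  open +-*-Solver using (solve; _:+_; _:-_; _:*_; _:=_)
  open FinSum ℚP.+-0-commutativeMonoid using (sum; sum-cong-≗; ∑-comm; ∑-when)
  open import Algebra.Properties.Semiring.Sum (CommutativeRing.semiring ℚP.+-*-commutativeRing)
    using (*-distribˡ-sum)

  sumℚ≡sum : ∀ {k} (f : Fin k → ℚ) → sumℚ f ≡ sum f
  sumℚ≡sum {zero}  f = refl
  sumℚ≡sum {suc k} f = cong (_+_ (f zero)) (sumℚ≡sum (f ∘ suc))

  ∑-distrib-minus : ∀ {k} (f g : Fin k → ℚ) → sum (λ i → f i - g i) ≡ sum f - sum g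
  ∑-distrib-minus {zero}  f g = refl
  ∑-distrib-minus {suc k} f g = trans (cong (_+_ (f zero - g zero)) (∑-distrib-minus (f ∘ suc) (g ∘ suc)))
    (solve 4 (λ a b c d → (a :- b) :+ (c :- d) := (a :+ c) :- (b :+ d)) refl
      (f zero) (g zero) (sum (f ∘ suc)) (sum (g ∘ suc)))

  ∑-nonneg : ∀ {k} (f : Fin k → ℚ) → (∀ i → 0ℚ ≤ f i) → 0ℚ ≤ sum f
  ∑-nonneg {zero}  f f≥0 = ℚP.≤-refl
  ∑-nonneg {suc k} f f≥0 = ℚP.+-mono-≤ (f≥0 zero) (∑-nonneg (f ∘ suc) (f≥0 ∘ suc))

  ∑-weighted-flow : ∀ (end : Fin n → Fin nQ) (w : Fin nQ → ℚ) (z : Fin n → ℚ) →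
    sum (λ q → w q * sumℚ (λ i → when (end i) q (z i) 0ℚ)) ≡ sum (λ i → w (end i) * z i)
  ∑-weighted-flow end w z = begin
    sum (λ q → w q * sumℚ (λ i → when (end i) q (z i) 0ℚ))
      ≡⟨ sum-cong-≗ (λ q → cong (w q *_) (sumℚ≡sum (λ i → when (end i) q (z i) 0ℚ))) ⟩
    sum (λ q → w q * sum (λ i → when (end i) q (z i) 0ℚ))
      ≡⟨ sum-cong-≗ (λ q → *-distribˡ-sum (w q) (λ i → when (end i) q (z i) 0ℚ)) ⟩
    sum (λ q → sum (λ i → w q * when (end i) q (z i) 0ℚ))
      ≡⟨ ∑-comm (λ q i → w q * when (end i) q (z i) 0ℚ) ⟩
    sum (λ i → sum (λ q → w q * when (end i) q (z i) 0ℚ))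
      ≡⟨ sum-cong-≗ (λ i → sum-cong-≗ (concentrate i)) ⟩
    sum (λ i → sum (λ q → when q (end i) (w (end i) * z i) 0ℚ))
      ≡⟨ sum-cong-≗ (λ i → ∑-when (end i) (w (end i) * z i)) ⟩
    sum (λ i → w (end i) * z i)
      ∎
    where
    open ≡-Reasoning
    concentrate : ∀ i q → w q * when (end i) q (z i) 0ℚ ≡ when q (end i) (w (end i) * z i) 0ℚ
    concentrate i q with end i ≟ q | q ≟ end i
    ... | yes refl | yes _    = refl
    ... | yes refl | no q≢q   = contradiction refl q≢q
    ... | no e≢q   | yes q≡e  = contradiction (sym q≡e) e≢q
    ... | no _     | no _     = ℚP.*-zeroʳ (w q)

  summation-by-parts : ∀ (w : Fin nQ → ℚ) (z : Fin n → ℚ) →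
    sum (λ q → w q * (inℚ A z q - outℚ A z q)) ≡ sum (λ i → (w (tgt i) - w (src i)) * z i)
  summation-by-parts w z = begin
    sum (λ q → w q * (inℚ A z q - outℚ A z q))
      ≡⟨ sum-cong-≗ (λ q → distribute (w q) (inℚ A z q) (outℚ A z q)) ⟩
    sum (λ q → w q * inℚ A z q - w q * outℚ A z q)
      ≡⟨ ∑-distrib-minus (λ q → w q * inℚ A z q) (λ q → w q * outℚ A z q) ⟩
    sum (λ q → w q * inℚ A z q) - sum (λ q → w q * outℚ A z q)
      ≡⟨ cong₂ _-_ (∑-weighted-flow tgt w z) (∑-weighted-flow src w z) ⟩
    sum (λ i → w (tgt i) * z i) - sum (λ i → w (src i) * z i)
      ≡⟨ sym (∑-distrib-minus (λ i → w (tgt i) * z i) (λ i → w (src i) * z i)) ⟩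
    sum (λ i → w (tgt i) * z i - w (src i) * z i)
      ≡⟨ sum-cong-≗ (λ i → factor (w (tgt i)) (w (src i)) (z i)) ⟩
    sum (λ i → (w (tgt i) - w (src i)) * z i)
      ∎
    where
    open ≡-Reasoning
    distribute : ∀ a b c → a * (b - c) ≡ a * b - a * c
    distribute = solve 3 (λ a b c → a :* (b :- c) := a :* b :- a :* c) refl
    factor : ∀ a b c → a * c - b * c ≡ (a - b) * c
    factor = solve 3 (λ a b c → a :* c :- b :* c := (a :- b) :* c) refl

  indicator : ∀ {P : Set} → Dec P → ℚ
  indicator (yes _) = 1ℚ
  indicator (no _)  = 0ℚ

  flow-cannot-escape : ∀ {S : Pred (Fin nQ) 0ℓ} (S? : Decidable S) {s u : Fin nQ} {P : ℚ}
    (z : Fin n → ℚ) → S s → ¬ S u → (∀ i → 0ℚ ≤ z i) → (∀ i → S (src i) → ¬ S (tgt i) → z i ≤ 0ℚ) →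
    (∀ q → inℚ A z q - outℚ A z q ≡ when q s (- P) (when q u P 0ℚ)) → 0ℚ ≤ - P
  flow-cannot-escape {S} S? {s} {u} {P} z Ss ¬Su z≥0 z-stays flows = begin
    0ℚ
      ≤⟨ ∑-nonneg _ inward ⟩
    sum (λ i → (χ (tgt i) - χ (src i)) * z i)
      ≡⟨ sym (summation-by-parts χ z) ⟩
    sum (λ q → χ q * (inℚ A z q - outℚ A z q))
      ≡⟨ sum-cong-≗ (λ q → cong (χ q *_) (flows q)) ⟩
    sum (λ q → χ q * when q s (- P) (when q u P 0ℚ))
      ≡⟨ sum-cong-≗ restrict ⟩
    sum (λ q → when q s (- P) 0ℚ)
      ≡⟨ ∑-when s (- P) ⟩
    - P
      ∎
    where
    open ℚP.≤-Reasoning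
    χ : Fin nQ → ℚ
    χ q = indicator (S? q)
    inward : ∀ i → 0ℚ ≤ (χ (tgt i) - χ (src i)) * z i
    inward i with S? (tgt i) | S? (src i)
    ... | yes _   | yes _   = ℚP.≤-reflexive (sym (ℚP.*-zeroˡ (z i)))
    ... | yes _   | no _    = subst (0ℚ ≤_) (sym (ℚP.*-identityˡ (z i))) (z≥0 i)
    ... | no _    | no _    = ℚP.≤-reflexive (sym (ℚP.*-zeroˡ (z i)))
    ... | no ¬to  | yes from =
      subst (λ c → 0ℚ ≤ (0ℚ - 1ℚ) * c) (sym (ℚP.≤-antisym (z-stays i from ¬to) (z≥0 i))) ℚP.≤-refl
    restrict : ∀ q → χ q * when q s (- P) (when q u P 0ℚ) ≡ when q s (- P) 0ℚ
    restrict q with q ≟ s | S? q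
    ... | yes refl | yes _   = ℚP.*-identityˡ (- P)
    ... | yes refl | no ¬Ss  = contradiction Ss ¬Ss
    ... | no _     | no _    = ℚP.*-zeroˡ (when q u P 0ℚ)
    ... | no _     | yes Sq  = trans (ℚP.*-identityˡ _) (when-≢ (λ q≡u → ¬Su (subst S q≡u Sq)))

  term≤sumℕ : ∀ {k} (f : Fin k → ℕ) i → f i ℕ.≤ sumℕ f
  term≤sumℕ f zero    = ℕP.m≤m+n (f zero) _
  term≤sumℕ f (suc i) = ℕP.≤-trans (term≤sumℕ (f ∘ suc) i) (ℕP.m≤n+m _ (f zero))

  used≤outℕ : ∀ (x : Fin n → ℕ) j → x j ℕ.≤ outℕ A x (src j)
  used≤outℕ x j = subst (ℕ._≤ outℕ A x (src j)) (when-≡ {a = src j} {x = x j} {0} refl)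
    (term≤sumℕ (λ i → when (src i) (src j) (x i) 0) j)

  p-nonpositive⇒outℕ≡0 : ∀ x q → 0ℚ ≤ - p A x q → outℕ A x q ≡ 0
  p-nonpositive⇒outℕ≡0 x q with outℕ A x q
  ... | zero  = λ _ → refl
  ... | suc _ = λ { (*≤* ()) }

  InF⇒reachable-support : ∀ {s d x} → InF A s d x → ReachableSupport x s
  InF⇒reachable-support {s} {d} {x} (_ , z , bounds , flows) {S} S? Ss closed j ¬Sj =
    ℕP.n≤0⇒n≡0 (subst (x j ℕ.≤_) (p-nonpositive⇒outℕ≡0 x u escape) (used≤outℕ x j))
    where
    u : Fin nQ
    u = src j
    u≢s : u ≢ s
    u≢s u≡s = ¬Sj (subst S (sym u≡s) Ss)
    escape : 0ℚ ≤ - p A x u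
    escape = flow-cannot-escape S? (z u) Ss ¬Sj (proj₁ ∘ bounds u u≢s)
      (λ i from ¬to → subst (λ k → z u i ≤ ℕ→ℚ k) (closed i from ¬to) (proj₂ (bounds u u≢s i)))
      (flows u u≢s)

lemma9p2 : (A : CA) (qf : Fin (CA.nQ A)) → FlowSetting A qf →
    (x : Fin (CA.n A) → ℕ) → Fx A qf x →
    Σ (List (Label A)) λ w → Σ (List (Fin (CA.n A))) λ ts →
      Steps A (w , CA.q0 A) ts ([] , qf) × (∀ j → count j ts ≡ x j)
lemma9p2 A qf (qf≢q0 , _) x x∈F@(balance , _) =
  let ts , path , uses-x = euler-path (InF⇒balanced (qf≢q0 ∘ sym) balance) (InF⇒reachable-support x∈F)
  in map (CA.lab A) ts , ts , steps path , uses-x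
  where
  open Flows A using (InF⇒balanced)
  open Euler A using (euler-path; steps)
  open Cut A using (InF⇒reachable-support)
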